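{- Let $p$ be an odd prime. There is a unique walk of maximal length on $\mathcal{G}_p$, there is a unique walk of maximal length among the $(p-1)$-recurrent walks on $\mathcal{G}_p$, and these two walks coincide.
   Context: The additive residue graph $\mathcal{G}_p$ is the directed labelled graph with vertex set $\mathbb{Z}/p\mathbb{Z}$ and, for each vertex $r$ and each $1\le i\le p-1$, an edge labelled $i$ (an $i$-edge) from $r$ to $r+i$. A walk on $\mathcal{G}_p$ means a finite walk starting at vertex $0$ whose edge labels are weakly increasing along the walk and which never returns to vertex $0$; its length is its number of edges. A walk is $(p-1)$-recurrent if for every $1\le i\le p-1$ it contains an $i$-edge incident to the vertex $p-1$ (i.e. starting or ending at $p-1$). -}

module Defs where

open import Data.Nat using (ℕ; zero; suc; _+_; _∸_; _≤_; _<_; NonZero)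
open import Data.Nat.DivMod using (_%_)
open import Data.List using (List; []; _∷_; length)
open import Data.List.Relation.Unary.All using (All)
open import Data.List.Relation.Unary.Linked using (Linked)
open import Data.List.Relation.Unary.Any using (Any)
open import Data.Product using (_×_; Σ; ∃; _,_)
open import Data.Sum using (_⊎_)
open import Relation.Binary.PropositionalEquality using (_≡_; _≢_)

-- A walk on G_p starting at vertex 0 is determined by its list of edge
-- labels ℓ₁, …, ℓₘ (each in {1,…,p-1}); the k-th edge goes from
-- (ℓ₁+…+ℓ_{k-1}) mod p to (ℓ₁+…+ℓ_k) mod p.  Vertices of Z/pZ are
-- represented by their residues in {0,…,p-1}.

record Edge : Set where
  constructor edge
  field
    src : ℕ
    lbl : ℕ
    tgt : ℕ

edgesFrom : (p : ℕ) .{{_ : NonZero p}} → ℕ → List ℕ → List Edge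
edgesFrom p s [] = []
edgesFrom p s (l ∷ ls) = edge s l ((s + l) % p) ∷ edgesFrom p ((s + l) % p) ls

edges : (p : ℕ) .{{_ : NonZero p}} → List ℕ → List Edge
edges p ls = edgesFrom p 0 ls

ValidLabel : ℕ → ℕ → Set
ValidLabel p i = 1 ≤ i × i ≤ p ∸ 1

IsWalk : (p : ℕ) .{{_ : NonZero p}} → List ℕ → Set
IsWalk p ls =
  All (ValidLabel p) ls ×
  Linked _≤_ ls ×
  All (λ e → Edge.tgt e ≢ 0) (edges p ls)

Recurrent : (p : ℕ) .{{_ : NonZero p}} → List ℕ → Set
Recurrent p ls =
  (i : ℕ) → 1 ≤ i → i ≤ p ∸ 1 →
  Any (λ e → Edge.lbl e ≡ i × (Edge.src e ≡ p ∸ 1 ⊎ Edge.tgt e ≡ p ∸ 1)) (edges p ls)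

UniqueMaximal : (P : List ℕ → Set) → List ℕ → Set
UniqueMaximal P w =
  P w ×
  ((w' : List ℕ) → P w' → length w' ≤ length w) ×
  ((w' : List ℕ) → P w' → length w' ≡ length w → w' ≡ w)

-- Write steps i v for the residue a < p with a * i ≡ v (mod p): the number of
-- i-edges leading from 0 to v.  It grows by one along each i-edge, and an i-edge
-- returns to 0 exactly when it leaves a vertex with steps i = p - 1.  At every
-- vertex v, steps i v - steps (i+1) v is at most drop i, the largest c with
-- c + (c * i mod p) < p.  Telescoping these bounds over the labels i, ..., p - 1
-- bounds the length of every walk, and equality forces the walk to leave each
-- label i exactly at the vertex where steps i = drop i + (drop i * i mod p).
-- So the longest walk is unique: the greedy walk that uses each label until it
-- reaches that vertex.  Oddness of p gives drop i ≥ (p - 1)/2, which ensures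
-- that the greedy walk enters each label below the value where it leaves it.
-- Comparing with drop once more shows that steps i (p - 1) lies between these
-- two values, so the greedy walk has an i-edge at p - 1 for every label i.

module Submission where

open import Data.Empty using (⊥-elim)
open import Data.Fin using (toℕ; fromℕ<)
open import Data.Fin.Properties using (any?; toℕ<n; toℕ-fromℕ<)
open import Data.List using (List; []; _∷_; length)
open import Data.List.Relation.Unary.All using (All; []; _∷_)
open import Data.List.Relation.Unary.Any using (Any; here; there)
open import Data.List.Relation.Unary.Linked using (Linked; [-]; _∷_; tail)
open import Data.Nat
open import Data.Nat.Coprimality using (prime⇒coprime; coprime-Bézout)
open import Data.Nat.DivMod
open import Data.Nat.Divisibility using (m%n≡0⇒n∣m)
open import Data.Nat.GCD using (module Bézout)
open import Data.Nat.Primality using (Prime; prime⇒irreducible; prime⇒nonZero; prime⇒nonTrivial)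
open import Data.Nat.Properties
open import Algebra.Properties.CommutativeSemigroup +-commutativeSemigroup using (x∙yz≈y∙xz)
open import Data.Nat.Tactic.RingSolver using (solve-∀)
open import Data.Product using (Σ; ∃-syntax; _×_; _,_; proj₁; proj₂)
open import Data.Sum using (_⊎_; inj₁; inj₂; [_,_]′)
open import Data.Unit using (⊤; tt)
open import Function using (_∘_)
open import Level using (0ℓ)
open import Relation.Binary.Bundles using (Setoid)
import Relation.Binary.Construct.On as On
open import Relation.Binary.PropositionalEquality
import Relation.Binary.Reasoning.Setoid as SetoidReasoning
open import Relation.Nullary using (¬_; yes; no)
open import Relation.Nullary.Decidable using (_×-dec_)
import Relation.Unary as U

open import Defs

module _ {P : ℕ → Set} (P? : U.Decidable P) where

  greatestBelow : ℕ → ℕ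
  greatestBelow zero    = 0
  greatestBelow (suc n) with P? n
  ... | yes _ = n
  ... | no  _ = greatestBelow n

  greatestBelow-greatest : ∀ {n c} → P c → c < n → c ≤ greatestBelow n
  greatestBelow-greatest {suc n} {c} Pc c<1+n with P? n | m<1+n⇒m<n∨m≡n c<1+n
  ... | yes _  | _          = ≤-pred c<1+n
  ... | no  _  | inj₁ c<n   = greatestBelow-greatest Pc c<n
  ... | no ¬Pn | inj₂ refl  = ⊥-elim (¬Pn Pc)

  greatestBelow-satisfies : ∀ {n c} → P c → c < n → P (greatestBelow n)
  greatestBelow-satisfies {suc n} {c} Pc c<1+n with P? n | m<1+n⇒m<n∨m≡n c<1+n
  ... | yes Pn | _          = Pn
  ... | no  _  | inj₁ c<n   = greatestBelow-satisfies Pc c<n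
  ... | no ¬Pn | inj₂ refl  = ⊥-elim (¬Pn Pc)

1+h+complement<p : ∀ {h p r r'} → p ≡ suc (h + h) → r' + r ≡ p → suc p ≤ h + r → suc h + r' < p
1+h+complement<p {h} {p} {r} {r'} p≡1+2h r'+r≡p p<h+r = +-cancelʳ-≤ (h + r) (suc (suc h + r')) p (begin
  suc (suc h + r') + (h + r)   ≡⟨ regroup h r r' ⟩
  suc (suc (h + h)) + (r' + r) ≡⟨ cong₂ (λ a b → suc a + b) (sym p≡1+2h) r'+r≡p ⟩
  suc p + p                    ≡⟨ +-comm (suc p) p ⟩
  p + suc p                    ≤⟨ +-monoʳ-≤ p p<h+r ⟩
  p + (h + r)                  ∎)
  where
  open ≤-Reasoning
  regroup : ∀ h r r' → suc (suc h + r') + (h + r) ≡ suc (suc (h + h)) + (r' + r)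
  regroup = solve-∀

sum-bounds-tight : ∀ {L a b g φ} → L + b ≤ φ → a ≤ g + b → L + a ≡ g + φ → L + b ≡ φ × a ≡ g + b
sum-bounds-tight {L} {a} {b} {g} {φ} L+b≤φ a≤g+b L+a≡g+φ =
  ≤-antisym L+b≤φ φ≤L+b , +-cancelˡ-≡ L a (g + b) (≤-antisym (+-monoʳ-≤ L a≤g+b) L+[g+b]≤L+a)
  where
  open ≤-Reasoning
  swap : L + (g + b) ≡ g + (L + b)
  swap = x∙yz≈y∙xz L g b
  φ≤L+b : φ ≤ L + b
  φ≤L+b = +-cancelˡ-≤ g φ (L + b) (begin
    g + φ       ≡⟨ L+a≡g+φ ⟨
    L + a       ≤⟨ +-monoʳ-≤ L a≤g+b ⟩
    L + (g + b) ≡⟨ swap ⟩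
    g + (L + b) ∎)
  L+[g+b]≤L+a : L + (g + b) ≤ L + a
  L+[g+b]≤L+a = begin
    L + (g + b) ≡⟨ swap ⟩
    g + (L + b) ≤⟨ +-monoʳ-≤ g L+b≤φ ⟩
    g + φ       ≡⟨ L+a≡g+φ ⟨
    L + a       ∎

module Congruence (p : ℕ) .{{_ : NonZero p}} where

  ≡-mod-setoid : Setoid 0ℓ 0ℓ
  ≡-mod-setoid = On.setoid (setoid ℕ) (_% p)
  module ≈-Reasoning = SetoidReasoning ≡-mod-setoid

  infix 4 _≈_
  _≈_ : ℕ → ℕ → Set
  a ≈ b = a % p ≡ b % p

  0<p : 0 < p
  0<p = >-nonZero⁻¹ p

  ≈-reduce : ∀ a → a % p ≈ a
  ≈-reduce a = m%n%n≡m%n a p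

  ≈-residue : ∀ {a b} → a < p → b < p → a ≈ b → a ≡ b
  ≈-residue {a} {b} a<p b<p a≈b = begin
    a     ≡⟨ m<n⇒m%n≡m a<p ⟨
    a % p ≡⟨ a≈b ⟩
    b % p ≡⟨ m<n⇒m%n≡m b<p ⟩
    b     ∎
    where open ≡-Reasoning

  +-cong : ∀ {a b c d} → a ≈ b → c ≈ d → a + c ≈ b + d
  +-cong {a} {b} {c} {d} a≈b c≈d = begin
    (a + c) % p         ≡⟨ %-distribˡ-+ a c p ⟩
    (a % p + c % p) % p ≡⟨ cong₂ (λ x y → (x + y) % p) a≈b c≈d ⟩
    (b % p + d % p) % p ≡⟨ %-distribˡ-+ b d p ⟨
    (b + d) % p         ∎
    where open ≡-Reasoning

  *-cong : ∀ {a b c d} → a ≈ b → c ≈ d → a * c ≈ b * d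
  *-cong {a} {b} {c} {d} a≈b c≈d = begin
    (a * c) % p             ≡⟨ %-distribˡ-* a c p ⟩
    (a % p * (c % p)) % p   ≡⟨ cong₂ (λ x y → (x * y) % p) a≈b c≈d ⟩
    (b % p * (d % p)) % p   ≡⟨ %-distribˡ-* b d p ⟨
    (b * d) % p             ∎
    where open ≡-Reasoning

  0%p≡0 : 0 % p ≡ 0
  0%p≡0 = m<n⇒m%n≡m 0<p

  p≈0 : p ≈ 0
  p≈0 = trans (n%n≡0 p) (sym 0%p≡0)

  +p≈ : ∀ a → a + p ≈ a
  +p≈ a = [m+n]%n≡m%n a p

  *p≈0 : ∀ a → a * p ≈ 0
  *p≈0 a = trans (m*n%n≡0 a p) (sym 0%p≡0)

  +-cancelˡ-≈ : ∀ a {b c} → a + b ≈ a + c → b ≈ c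
  +-cancelˡ-≈ a {b} {c} a+b≈a+c = begin
    b               ≈⟨ undo b ⟨
    k + (a + b)     ≈⟨ +-cong {k} refl a+b≈a+c ⟩
    k + (a + c)     ≈⟨ undo c ⟩
    c               ∎
    where
    open ≈-Reasoning
    k : ℕ
    k = p ∸ a % p
    undo : ∀ x → k + (a + x) ≈ x
    undo x = begin
      k + (a + x)     ≈⟨ +-cong {k} refl (+-cong (≈-reduce a) refl) ⟨
      k + (a % p + x) ≡⟨ +-assoc k (a % p) x ⟨
      k + a % p + x   ≡⟨ cong (_+ x) (m∸n+n≡m (m%n≤n a p)) ⟩
      p + x           ≡⟨ +-comm p x ⟩
      x + p           ≈⟨ +p≈ x ⟩
      x               ∎

  +-cancelʳ-≈ : ∀ a {b c} → b + a ≈ c + a → b ≈ c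
  +-cancelʳ-≈ a {b} {c} e = +-cancelˡ-≈ a (subst₂ _≈_ (+-comm b a) (+-comm c a) e)

  residues-sum≈0⇒≡p : ∀ {x y} → 0 < x → x < p → y < p → x + y ≈ 0 → x + y ≡ p
  residues-sum≈0⇒≡p {x} {y} 0<x x<p y<p x+y≈0 with x + y <? p
  ... | yes x+y<p = ⊥-elim (<⇒≢ (≤-trans 0<x (m≤m+n x y))
                      (sym (≈-residue x+y<p 0<p x+y≈0)))
  ... | no  x+y≮p = ≤-antisym x+y≤p p≤x+y
    where
    p≤x+y : p ≤ x + y
    p≤x+y = ≮⇒≥ x+y≮p
    excess<p : x + y ∸ p < p
    excess<p = subst (x + y ∸ p <_) (m+n∸n≡m p p) (∸-monoˡ-< (+-mono-< x<p y<p) p≤x+y)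
    excess≡0 : x + y ∸ p ≡ 0
    excess≡0 = ≈-residue excess<p 0<p (trans (m≤n⇒[n∸m]%m≡n%m p≤x+y) x+y≈0)
    x+y≤p : x + y ≤ p
    x+y≤p = m∸n≡0⇒m≤n excess≡0

module Units (p : ℕ) .{{_ : NonZero p}} (p-prime : Prime p) where

  open Congruence p

  inverse : ∀ {i} → 0 < i → i < p → ∃[ u ] u * i ≈ 1
  inverse {i} 0<i i<p with coprime-Bézout (prime⇒coprime p-prime {{>-nonZero 0<i}} i<p)
  ... | Bézout.-+ x y 1+xp≡yi = y , sym (trans (sym ([m+kn]%n≡m%n 1 x p)) (cong (_% p) 1+xp≡yi))
  ... | Bézout.+- x y 1+yi≡xp = q * y , +-cancelʳ-≈ q (begin
      q * y * i + q   ≡⟨ distrib q y i ⟩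
      q * (1 + y * i) ≡⟨ cong (q *_) 1+yi≡xp ⟩
      q * (x * p)     ≡⟨ *-assoc q x p ⟨
      q * x * p       ≈⟨ *p≈0 (q * x) ⟩
      0               ≈⟨ p≈0 ⟨
      p               ≡⟨ m+[n∸m]≡n 0<p ⟨
      1 + q           ∎)
    where
    open ≈-Reasoning
    q : ℕ
    q = p ∸ 1
    distrib : ∀ q y i → q * y * i + q ≡ q * (1 + y * i)
    distrib = solve-∀

  *-cancelʳ-≈ : ∀ {i a b} → 0 < i → i < p → a * i ≈ b * i → a ≈ b
  *-cancelʳ-≈ {i} {a} {b} 0<i i<p ai≈bi = begin
    a           ≡⟨ *-identityʳ a ⟨
    a * 1       ≈⟨ *-cong {a} refl ui≈1 ⟨
    a * (u * i) ≡⟨ swap a ⟩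
    a * i * u   ≈⟨ *-cong ai≈bi (refl {x = u % p}) ⟩
    b * i * u   ≡⟨ swap b ⟨
    b * (u * i) ≈⟨ *-cong {b} refl ui≈1 ⟩
    b * 1       ≡⟨ *-identityʳ b ⟩
    b           ∎
    where
    open ≈-Reasoning
    u : ℕ
    u = proj₁ (inverse 0<i i<p)
    ui≈1 : u * i ≈ 1
    ui≈1 = proj₂ (inverse 0<i i<p)
    swap : ∀ x → x * (u * i) ≡ x * i * u
    swap x = trans (cong (x *_) (*-comm u i)) (sym (*-assoc x i u))

  unit*≢0 : ∀ {a i} → 0 < a → a < p → 0 < i → i < p → ¬ (a * i ≈ 0)
  unit*≢0 {a} 0<a a<p 0<i i<p ai≈0 =
    <⇒≢ 0<a (sym (≈-residue a<p 0<p (*-cancelʳ-≈ {b = 0} 0<i i<p ai≈0)))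

  -- Found by search; the search succeeds because i is invertible modulo p.
  steps : ℕ → ℕ → ℕ
  steps i v with any? {n = p} (λ c → (toℕ c * i) % p ≟ v % p)
  ... | yes (c , _) = toℕ c
  ... | no _        = 0

  module _ {i : ℕ} (0<i : 0 < i) (i<p : i < p) where

    steps-spec : ∀ v → steps i v < p × steps i v * i ≈ v
    steps-spec v with any? {n = p} (λ c → (toℕ c * i) % p ≟ v % p)
    ... | yes (c , ci≈v) = toℕ<n c , ci≈v
    ... | no ∄c          = ⊥-elim (∄c (fromℕ< vu%p<p , vu%p*i≈v))
      where
      open ≈-Reasoning
      u : ℕ
      u = proj₁ (inverse 0<i i<p)
      vu%p<p : (v * u) % p < p
      vu%p<p = m%n<n (v * u) p
      vu%p*i≈v : toℕ (fromℕ< vu%p<p) * i ≈ v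
      vu%p*i≈v = begin
        toℕ (fromℕ< vu%p<p) * i ≡⟨ cong (_* i) (toℕ-fromℕ< vu%p<p) ⟩
        (v * u) % p * i         ≈⟨ *-cong (≈-reduce (v * u)) (refl {x = i % p}) ⟩
        v * u * i               ≡⟨ *-assoc v u i ⟩
        v * (u * i)             ≈⟨ *-cong {v} refl (proj₂ (inverse 0<i i<p)) ⟩
        v * 1                   ≡⟨ *-identityʳ v ⟩
        v                       ∎

    steps<p : ∀ v → steps i v < p
    steps<p v = proj₁ (steps-spec v)

    steps-sound : ∀ v → steps i v * i ≈ v
    steps-sound v = proj₂ (steps-spec v)

    steps-unique : ∀ {a} v → a < p → a * i ≈ v → steps i v ≡ a
    steps-unique v a<p ai≈v =
      ≈-residue (steps<p v) a<p (*-cancelʳ-≈ 0<i i<p (trans (steps-sound v) (sym ai≈v)))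

    steps-injective : ∀ {v w} → v < p → w < p → steps i v ≡ steps i w → v ≡ w
    steps-injective {v} {w} v<p w<p eq = ≈-residue v<p w<p (begin
      v            ≈⟨ steps-sound v ⟨
      steps i v * i ≡⟨ cong (_* i) eq ⟩
      steps i w * i ≈⟨ steps-sound w ⟩
      w            ∎)
      where open ≈-Reasoning

    steps-positive : ∀ {v} → v < p → v ≢ 0 → 1 ≤ steps i v
    steps-positive {v} v<p v≢0 = n≢0⇒n>0 λ a≡0 → v≢0 (≈-residue v<p 0<p (begin
      v              ≈⟨ steps-sound v ⟨
      steps i v * i  ≡⟨ cong (_* i) a≡0 ⟩
      0              ∎))
      where open ≈-Reasoning

    complement-of-steps[p∸1] : (p ∸ steps i (p ∸ 1)) * i ≈ 1
    complement-of-steps[p∸1] = +-cancelʳ-≈ (p ∸ 1) (begin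
      w * i + (p ∸ 1)   ≈⟨ +-cong {w * i} refl (steps-sound (p ∸ 1)) ⟨
      w * i + x * i     ≡⟨ *-distribʳ-+ i w x ⟨
      (w + x) * i       ≡⟨ cong (_* i) (m∸n+n≡m (<⇒≤ (steps<p (p ∸ 1)))) ⟩
      p * i             ≡⟨ *-comm p i ⟩
      i * p             ≈⟨ *p≈0 i ⟩
      0                 ≈⟨ p≈0 ⟨
      p                 ≡⟨ suc-pred p ⟨
      1 + (p ∸ 1)       ∎)
      where
      open ≈-Reasoning
      x w : ℕ
      x = steps i (p ∸ 1)
      w = p ∸ x

    steps-0 : steps i 0 ≡ 0
    steps-0 = steps-unique 0 0<p refl

    suc-steps*i≈target : ∀ s → suc (steps i s) * i ≈ (s + i) % p
    suc-steps*i≈target s = begin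
      i + steps i s * i ≈⟨ +-cong {i} refl (steps-sound s) ⟩
      i + s             ≡⟨ +-comm i s ⟩
      s + i             ≈⟨ ≈-reduce (s + i) ⟨
      (s + i) % p       ∎
      where open ≈-Reasoning

    steps-edge : ∀ s → suc (steps i s) < p → steps i ((s + i) % p) ≡ suc (steps i s)
    steps-edge s lt = steps-unique _ lt (suc-steps*i≈target s)

    steps<⇒target≢0 : ∀ s → suc (steps i s) < p → (s + i) % p ≢ 0
    steps<⇒target≢0 s lt eq = 1+n≢0 (begin
      suc (steps i s)        ≡⟨ steps-edge s lt ⟨
      steps i ((s + i) % p)  ≡⟨ cong (steps i) eq ⟩
      steps i 0              ≡⟨ steps-0 ⟩
      0                      ∎)
      where open ≡-Reasoning

    target≢0⇒steps< : ∀ s → (s + i) % p ≢ 0 → suc (steps i s) < p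
    target≢0⇒steps< s t≢0 with m≤n⇒m<n∨m≡n (steps<p s)
    ... | inj₁ lt = lt
    ... | inj₂ eq = ⊥-elim (t≢0 (≈-residue (m%n<n (s + i) p) 0<p (begin
      (s + i) % p         ≈⟨ suc-steps*i≈target s ⟨
      suc (steps i s) * i ≡⟨ cong (_* i) eq ⟩
      p * i               ≡⟨ *-comm p i ⟩
      i * p               ≈⟨ *p≈0 i ⟩
      0                   ∎)))
      where open ≈-Reasoning

    steps-edge-to-nonzero : ∀ s → (s + i) % p ≢ 0 → steps i ((s + i) % p) ≡ suc (steps i s)
    steps-edge-to-nonzero s t≢0 = steps-edge s (target≢0⇒steps< s t≢0)

module OddPrime (p : ℕ) .{{_ : NonZero p}} (p-prime : Prime p)
                (h : ℕ) (p≡1+2h : p ≡ suc (h + h)) (1≤h : 1 ≤ h) where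

  open Congruence p
  open Units p p-prime

  h<p : h < p
  h<p = subst (h <_) (sym p≡1+2h) (s≤s (m≤m+n h h))

  1+h<p : suc h < p
  1+h<p = subst (suc h <_) (sym p≡1+2h) (s≤s (subst (_≤ h + h) (+-comm h 1) (+-monoʳ-≤ h 1≤h)))

  p∸1<p : p ∸ 1 < p
  p∸1<p = m≤pred[n]⇒suc[m]≤n ≤-refl

  p∸1≢0 : p ∸ 1 ≢ 0
  p∸1≢0 p∸1≡0 = <⇒≢ 1≤h (sym (m+n≡0⇒m≡0 h (trans (cong (_∸ 1) (sym p≡1+2h)) p∸1≡0)))

  -- Modelled on a positive difference c = steps i v ∸ steps (suc i) v, for which
  -- c * i ≡ steps (suc i) v (mod p), see steps-difference.
  Admissible : ℕ → ℕ → Set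
  Admissible i c = 1 ≤ c × c + (c * i) % p < p

  admissible? : ∀ i → U.Decidable (Admissible i)
  admissible? i c = (1 ≤? c) ×-dec (c + (c * i) % p <? p)

  drop entry exit : ℕ → ℕ
  drop  i = greatestBelow (admissible? i) p
  entry i = (drop i * i) % p
  exit  i = drop i + entry i

  module _ {i : ℕ} (0<i : 0 < i) (1+i<p : suc i < p) where

    private
      i<p : i < p
      i<p = <-trans (n<1+n i) 1+i<p

    -- Since h + (h + 1) = p, the residues of h * i and (h + 1) * i sum to p.
    h-or-1+h-admissible : Admissible i h ⊎ Admissible i (suc h)
    h-or-1+h-admissible with h + r <? p
      where r = (h * i) % p
    ... | yes lt = inj₁ (1≤h , lt)
    ... | no ¬lt = inj₂ (s≤s z≤n , 1+h+complement<p {h} p≡1+2h r'+r≡p p<h+r)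
      where
      open ≈-Reasoning
      r r' : ℕ
      r  = (h * i) % p
      r' = (suc h * i) % p
      r'+r≡p : r' + r ≡ p
      r'+r≡p = residues-sum≈0⇒≡p r'>0 (m%n<n _ p) (m%n<n _ p) (begin
        r' + r              ≈⟨ +-cong (≈-reduce (suc h * i)) (≈-reduce (h * i)) ⟩
        suc h * i + h * i   ≡⟨ *-distribʳ-+ i (suc h) h ⟨
        (suc h + h) * i     ≡⟨ cong (_* i) (sym p≡1+2h) ⟩
        p * i               ≡⟨ *-comm p i ⟩
        i * p               ≈⟨ *p≈0 i ⟩
        0                   ∎)
        where
        r'>0 : 0 < r'
        r'>0 = n≢0⇒n>0 (λ r'≡0 → unit*≢0 (s≤s z≤n) 1+h<p 0<i i<p (trans r'≡0 (sym 0%p≡0)))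
      h+r≢p : h + r ≢ p
      h+r≢p h+r≡p = unit*≢0 1≤h h<p (s≤s z≤n) 1+i<p (begin
        h * suc i  ≡⟨ *-suc h i ⟩
        h + h * i  ≈⟨ +-cong {h} refl (≈-reduce (h * i)) ⟨
        h + r      ≡⟨ h+r≡p ⟩
        p          ≈⟨ p≈0 ⟩
        0          ∎)
      p<h+r : suc p ≤ h + r
      p<h+r = ≤∧≢⇒< (≮⇒≥ ¬lt) (λ eq → h+r≢p (sym eq))

    admissible-by : ∀ {c r} → 1 ≤ c → c * i ≈ r → r < p → c + r < p → Admissible i c
    admissible-by {c} 1≤c ci≈r r<p c+r<p =
      1≤c , subst (λ x → c + x < p) (sym (trans ci≈r (m<n⇒m%n≡m r<p))) c+r<p

    admissible⇒≤drop : ∀ {c} → Admissible i c → c ≤ drop i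
    admissible⇒≤drop {c} adm = greatestBelow-greatest (admissible? i) adm (≤-<-trans (m≤m+n c _) (proj₂ adm))

    beyond-drop-inadmissible : ∀ {y} → 1 ≤ y → ¬ Admissible i (drop i + y)
    beyond-drop-inadmissible {y} 1≤y adm =
      <⇒≱ (subst (drop i <_) (+-comm y (drop i)) (m<n+m (drop i) 1≤y)) (admissible⇒≤drop adm)

    drop-admissible : Admissible i (drop i)
    drop-admissible with h-or-1+h-admissible
    ... | inj₁ adm = greatestBelow-satisfies (admissible? i) adm h<p
    ... | inj₂ adm = greatestBelow-satisfies (admissible? i) adm 1+h<p

    h≤drop : h ≤ drop i
    h≤drop with h-or-1+h-admissible
    ... | inj₁ adm = admissible⇒≤drop adm
    ... | inj₂ adm = ≤-trans (n≤1+n h) (admissible⇒≤drop adm)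

    1≤drop : 1 ≤ drop i
    1≤drop = proj₁ drop-admissible

    exit<p : exit i < p
    exit<p = proj₂ drop-admissible

    drop<p : drop i < p
    drop<p = ≤-<-trans (m≤m+n (drop i) (entry i)) exit<p

    entry<p : entry i < p
    entry<p = m%n<n (drop i * i) p

    1≤entry : 1 ≤ entry i
    1≤entry = n≢0⇒n>0 (λ entry≡0 → unit*≢0 1≤drop drop<p 0<i i<p (trans entry≡0 (sym 0%p≡0)))

    entry≤h : entry i ≤ h
    entry≤h = ≤-pred (+-cancelˡ-≤ h (suc (entry i)) (suc h) (begin
      h + suc (entry i)     ≡⟨ +-suc h (entry i) ⟩
      suc (h + entry i)     ≤⟨ s≤s (+-monoˡ-≤ (entry i) h≤drop) ⟩
      suc (exit i)          ≤⟨ exit<p ⟩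
      p                     ≡⟨ p≡1+2h ⟩
      suc (h + h)           ≡⟨ +-suc h h ⟨
      h + suc h             ∎))
      where open ≤-Reasoning

    steps-difference : ∀ v → steps (suc i) v < steps i v →
                       let c = steps i v ∸ steps (suc i) v in
                       Admissible i c × (c * i) % p ≡ steps (suc i) v
    steps-difference v b<a = admissible-by (m<n⇒0<n∸m b<a) ci≈b b<p c+b<p , trans ci≈b (m<n⇒m%n≡m b<p)
      where
      a b c : ℕ
      a = steps i v
      b = steps (suc i) v
      c = a ∸ b
      b+c≡a : b + c ≡ a
      b+c≡a = m+[n∸m]≡n (<⇒≤ b<a)
      c+b<p : c + b < p
      c+b<p = subst (_< p) (sym (trans (+-comm c b) b+c≡a)) (steps<p 0<i i<p v)
      ci≈b : c * i ≈ b
      ci≈b = +-cancelˡ-≈ (b * i) (begin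
        b * i + c * i   ≡⟨ *-distribʳ-+ i b c ⟨
        (b + c) * i     ≡⟨ cong (_* i) b+c≡a ⟩
        a * i           ≈⟨ steps-sound 0<i i<p v ⟩
        v               ≈⟨ steps-sound (s≤s z≤n) 1+i<p v ⟨
        b * suc i       ≡⟨ *-suc b i ⟩
        b + b * i       ≡⟨ +-comm b (b * i) ⟩
        b * i + b       ∎)
        where open ≈-Reasoning
      b<p = steps<p (s≤s z≤n) 1+i<p v

    steps≤drop+steps : ∀ v → steps i v ≤ drop i + steps (suc i) v
    steps≤drop+steps v with steps (suc i) v <? steps i v
    ... | no  a≤b = ≤-trans (≮⇒≥ a≤b) (m≤n+m _ (drop i))
    ... | yes b<a = begin
      steps i v                           ≡⟨ m∸n+n≡m (<⇒≤ b<a) ⟨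
      (steps i v ∸ b) + b                 ≤⟨ +-monoˡ-≤ b (admissible⇒≤drop (proj₁ (steps-difference v b<a))) ⟩
      drop i + b                          ∎
      where
      open ≤-Reasoning
      b : ℕ
      b = steps (suc i) v

    steps≡drop+steps⇒exit : ∀ v → steps i v ≡ drop i + steps (suc i) v → steps i v ≡ exit i
    steps≡drop+steps⇒exit v a≡d+b = trans a≡d+b (cong (drop i +_) (begin
      b                                     ≡⟨ proj₂ (steps-difference v b<a) ⟨
      ((steps i v ∸ b) * i) % p             ≡⟨ cong (λ c → (c * i) % p) a∸b≡d ⟩
      entry i                               ∎))
      where
      open ≡-Reasoning
      b : ℕ
      b = steps (suc i) v
      b<a : b < steps i v
      b<a = subst (b <_) (sym a≡d+b) (+-monoˡ-≤ b 1≤drop)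
      a∸b≡d : steps i v ∸ b ≡ drop i
      a∸b≡d = trans (cong (_∸ b) a≡d+b) (m+n∸n≡m (drop i) b)

    exit⇒steps≡entry : ∀ v → steps i v ≡ exit i → steps (suc i) v ≡ entry i
    exit⇒steps≡entry v a≡exit = steps-unique (s≤s z≤n) 1+i<p v entry<p (begin
      entry i * suc i               ≡⟨ *-suc (entry i) i ⟩
      entry i + entry i * i         ≈⟨ +-cong (≈-reduce (drop i * i)) (refl {x = (entry i * i) % p}) ⟩
      drop i * i + entry i * i      ≡⟨ *-distribʳ-+ i (drop i) (entry i) ⟨
      exit i * i                    ≡⟨ cong (_* i) a≡exit ⟨
      steps i v * i                 ≈⟨ steps-sound 0<i i<p v ⟩
      v                             ∎)
      where open ≈-Reasoning

    entry≤steps[p∸1] : entry i ≤ steps (suc i) (p ∸ 1)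
    entry≤steps[p∸1] = ≮⇒≥ y≮entry
      where
      y : ℕ
      y = steps (suc i) (p ∸ 1)
      y≮entry : ¬ (y < entry i)
      y≮entry y<entry = beyond-drop-inadmissible 1≤y
                          (admissible-by (≤-trans 1≤drop (m≤m+n (drop i) y)) cy≈d d<p c+d<p)
        where
        d : ℕ
        d = entry i ∸ suc y
        1+y+d≡entry : suc y + d ≡ entry i
        1+y+d≡entry = m+[n∸m]≡n y<entry
        1≤y : 1 ≤ y
        1≤y = steps-positive (s≤s z≤n) 1+i<p p∸1<p p∸1≢0
        cy≈d : (drop i + y) * i ≈ d
        cy≈d = +-cancelʳ-≈ (suc y) (begin
          (drop i + y) * i + suc y  ≡⟨ regroup (drop i) y i ⟩
          drop i * i + suc (y * suc i) ≈⟨ +-cong (sym (≈-reduce (drop i * i))) (+-cong {1} refl y*[1+i]≈p∸1) ⟩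
          entry i + suc (p ∸ 1)     ≡⟨ cong (entry i +_) (suc-pred p) ⟩
          entry i + p               ≈⟨ +p≈ (entry i) ⟩
          entry i                   ≡⟨ trans (sym 1+y+d≡entry) (+-comm (suc y) d) ⟩
          d + suc y                 ∎)
          where
          open ≈-Reasoning
          y*[1+i]≈p∸1 : y * suc i ≈ p ∸ 1
          y*[1+i]≈p∸1 = steps-sound (s≤s z≤n) 1+i<p (p ∸ 1)
          regroup : ∀ g y i → (g + y) * i + suc y ≡ g * i + suc (y * suc i)
          regroup = solve-∀
        d<p : d < p
        d<p = ≤-<-trans (m∸n≤m (entry i) (suc y)) entry<p
        c+d<p : drop i + y + d < p
        c+d<p = ≤-<-trans (begin
          drop i + y + d         ≡⟨ +-assoc (drop i) y d ⟩
          drop i + (y + d)       ≤⟨ +-monoʳ-≤ (drop i) (n≤1+n (y + d)) ⟩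
          drop i + (suc y + d)   ≡⟨ cong (drop i +_) 1+y+d≡entry ⟩
          exit i                 ∎) exit<p
          where open ≤-Reasoning

    -- Otherwise c = drop i + (p ∸ steps i (p ∸ 1)) satisfies c * i ≡ entry i + 1,
    -- so either c is admissible or c * (i + 1) ≡ 0.
    steps[p∸1]≤exit : steps i (p ∸ 1) ≤ exit i
    steps[p∸1]≤exit = ≮⇒≥ exit≮x
      where
      x : ℕ
      x = steps i (p ∸ 1)
      exit≮x : ¬ (exit i < x)
      exit≮x exit<x = [ c+1+entry≮p , c+1+entry≢p ]′ (m≤n⇒m<n∨m≡n c+1+entry≤p)
        where
        w : ℕ
        w = p ∸ x
        w+x≡p : w + x ≡ p
        w+x≡p = m∸n+n≡m (<⇒≤ (steps<p 0<i i<p (p ∸ 1)))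
        1≤w : 1 ≤ w
        1≤w = m<n⇒0<n∸m (steps<p 0<i i<p (p ∸ 1))
        c : ℕ
        c = drop i + w
        1≤c : 1 ≤ c
        1≤c = ≤-trans 1≤drop (m≤m+n (drop i) w)
        ci≈1+entry : c * i ≈ suc (entry i)
        ci≈1+entry = begin
          (drop i + w) * i   ≡⟨ *-distribʳ-+ i (drop i) w ⟩
          drop i * i + w * i ≈⟨ +-cong (sym (≈-reduce (drop i * i))) (complement-of-steps[p∸1] 0<i i<p) ⟩
          entry i + 1        ≡⟨ +-comm (entry i) 1 ⟩
          suc (entry i)      ∎
          where open ≈-Reasoning
        c+1+entry≤p : c + suc (entry i) ≤ p
        c+1+entry≤p = begin
          drop i + w + suc (entry i)  ≡⟨ regroup (drop i) w (entry i) ⟩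
          suc (exit i) + w            ≤⟨ +-monoˡ-≤ w exit<x ⟩
          x + w                       ≡⟨ +-comm x w ⟩
          w + x                       ≡⟨ w+x≡p ⟩
          p                           ∎
          where
          open ≤-Reasoning
          regroup : ∀ g w e → g + w + suc e ≡ suc (g + e) + w
          regroup = solve-∀
        c+1+entry≮p : ¬ (c + suc (entry i) < p)
        c+1+entry≮p c+1+entry<p = beyond-drop-inadmissible 1≤w
          (admissible-by 1≤c ci≈1+entry (≤-<-trans (s≤s entry≤h) 1+h<p) c+1+entry<p)
        c+1+entry≢p : c + suc (entry i) ≢ p
        c+1+entry≢p c+1+entry≡p = unit*≢0 1≤c c<p (s≤s z≤n) 1+i<p (begin
          c * suc i         ≡⟨ *-suc c i ⟩
          c + c * i         ≈⟨ +-cong {c} refl ci≈1+entry ⟩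
          c + suc (entry i) ≡⟨ c+1+entry≡p ⟩
          p                 ≈⟨ p≈0 ⟩
          0                 ∎)
          where
          open ≈-Reasoning
          c<p : c < p
          c<p = subst (c <_) c+1+entry≡p (m<m+n c (s≤s z≤n))


  WalkFrom : ℕ → ℕ → List ℕ → Set
  WalkFrom i s []       = ⊤
  WalkFrom i s (l ∷ ls) = i ≤ l × l ≤ p ∸ 1 × (s + l) % p ≢ 0 × WalkFrom l ((s + l) % p) ls

  linked⇒walkFrom : ∀ {i s} ls → Linked _≤_ (i ∷ ls) → All (ValidLabel p) ls →
                    All (λ e → Edge.tgt e ≢ 0) (edgesFrom p s ls) → WalkFrom i s ls
  linked⇒walkFrom []       _                  _                 _               = tt
  linked⇒walkFrom (l ∷ ls) (i≤l ∷ linked) ((_ , l≤p∸1) ∷ valid) (t≢0 ∷ nonzero) =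
    i≤l , l≤p∸1 , t≢0 , linked⇒walkFrom ls linked valid nonzero

  walkFrom⇒linked : ∀ {i s} ls → 1 ≤ i → WalkFrom i s ls →
                    Linked _≤_ (i ∷ ls) × All (ValidLabel p) ls × All (λ e → Edge.tgt e ≢ 0) (edgesFrom p s ls)
  walkFrom⇒linked []       _   _                           = [-] , [] , []
  walkFrom⇒linked (l ∷ ls) 1≤i (i≤l , l≤p∸1 , t≢0 , walk) =
    let linked , valid , nonzero = walkFrom⇒linked ls (≤-trans 1≤i i≤l) walk
    in  i≤l ∷ linked , (≤-trans 1≤i i≤l , l≤p∸1) ∷ valid , t≢0 ∷ nonzero

  isWalk⇒walkFrom : ∀ ls → IsWalk p ls → WalkFrom 1 0 ls
  isWalk⇒walkFrom []       _                           = tt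
  isWalk⇒walkFrom (l ∷ ls) (valid@(vl ∷ _) , linked , nonzero) =
    linked⇒walkFrom (l ∷ ls) (proj₁ vl ∷ linked) valid nonzero

  walkFrom⇒isWalk : ∀ ls → WalkFrom 1 0 ls → IsWalk p ls
  walkFrom⇒isWalk ls walk =
    let linked , valid , nonzero = walkFrom⇒linked ls ≤-refl walk
    in  valid , tail linked , nonzero

  level<p : ∀ {i k} → i + k ≡ p ∸ 1 → i < p
  level<p {i} {k} lvl = m≤pred[n]⇒suc[m]≤n (subst (i ≤_) lvl (m≤m+n i k))

  next-level : ∀ {i k} → i + suc k ≡ p ∸ 1 → suc i + k ≡ p ∸ 1
  next-level {i} {k} lvl = trans (sym (+-suc i k)) lvl

  no-label-above : ∀ {i l} → i + 0 ≡ p ∸ 1 → i < l → ¬ (l ≤ p ∸ 1)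
  no-label-above {i} lvl i<l l≤p∸1 = <⇒≱ i<l (subst (_ ≤_) (trans (sym lvl) (+-identityʳ i)) l≤p∸1)

  -- Label i is paired with the number k of labels above it, i + k ≡ p ∸ 1.
  -- ceiling i k is the value of steps i at which the longest walk leaves label i,
  -- and greedy i k s n takes n i-edges from s before moving on to label suc i.
  potential : ℕ → ℕ → ℕ
  potential i zero    = p ∸ 1
  potential i (suc k) = drop i + potential (suc i) k

  ceiling : ℕ → ℕ → ℕ
  ceiling i zero    = p ∸ 1
  ceiling i (suc k) = exit i

  greedy : ℕ → ℕ → ℕ → ℕ → List ℕ
  greedy i k       s (suc n) = i ∷ greedy i k ((s + i) % p) n
  greedy i zero    s zero    = []
  greedy i (suc k) s zero    = greedy (suc i) k s (ceiling (suc i) k ∸ steps (suc i) s)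

  p∸1≤potential : ∀ i k → p ∸ 1 ≤ potential i k
  p∸1≤potential i zero    = ≤-refl
  p∸1≤potential i (suc k) = ≤-trans (p∸1≤potential (suc i) k) (m≤n+m _ (drop i))

  walk-length+steps≤potential : ∀ k {i} → i + k ≡ p ∸ 1 → 0 < i → ∀ {s} ls → WalkFrom i s ls →
                                length ls + steps i s ≤ potential i k
  walk-length+steps≤potential k lvl 0<i {s} [] _ =
    ≤-trans (<⇒≤pred (steps<p 0<i (level<p lvl) s)) (p∸1≤potential _ k)
  walk-length+steps≤potential k {i} lvl 0<i {s} (l ∷ ls) (i≤l , l≤p∸1 , t≢0 , walk)
    with m≤n⇒m<n∨m≡n i≤l
  ... | inj₂ refl = subst (_≤ potential i k) (trans (cong (length ls +_) a′≡1+a) (+-suc _ _))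
                      (walk-length+steps≤potential k lvl 0<i ls walk)
    where
    a′≡1+a : steps i ((s + i) % p) ≡ suc (steps i s)
    a′≡1+a = steps-edge-to-nonzero 0<i (level<p lvl) s t≢0
  walk-length+steps≤potential zero    lvl 0<i (l ∷ ls) (i≤l , l≤p∸1 , t≢0 , walk) | inj₁ i<l =
    ⊥-elim (no-label-above lvl i<l l≤p∸1)
  walk-length+steps≤potential (suc k) {i} lvl 0<i {s} (l ∷ ls) (i≤l , l≤p∸1 , t≢0 , walk) | inj₁ i<l = begin
    L + steps i s                        ≤⟨ +-monoʳ-≤ L (steps≤drop+steps 0<i (level<p (next-level lvl)) s) ⟩
    L + (drop i + steps (suc i) s)       ≡⟨ x∙yz≈y∙xz L (drop i) _ ⟩
    drop i + (L + steps (suc i) s)       ≤⟨ +-monoʳ-≤ (drop i) bound-above ⟩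
    drop i + potential (suc i) k         ∎
    where
    open ≤-Reasoning
    L : ℕ
    L = length (l ∷ ls)
    bound-above : L + steps (suc i) s ≤ potential (suc i) k
    bound-above = walk-length+steps≤potential k (next-level lvl) (s≤s z≤n) (l ∷ ls) (i<l , l≤p∸1 , t≢0 , walk)

  ceiling<p : ∀ k {i} → i + k ≡ p ∸ 1 → 0 < i → ceiling i k < p
  ceiling<p zero    lvl 0<i = p∸1<p
  ceiling<p (suc k) lvl 0<i = exit<p 0<i (level<p (next-level lvl))

  steps[p∸1]≤ceiling : ∀ k {i} → i + k ≡ p ∸ 1 → 0 < i → steps i (p ∸ 1) ≤ ceiling i k
  steps[p∸1]≤ceiling zero    lvl 0<i = <⇒≤pred (steps<p 0<i (level<p lvl) (p ∸ 1))
  steps[p∸1]≤ceiling (suc k) lvl 0<i = steps[p∸1]≤exit 0<i (level<p (next-level lvl))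

  entry<ceiling : ∀ k {i} → i + suc k ≡ p ∸ 1 → 0 < i → entry i < ceiling (suc i) k
  entry<ceiling zero {i} lvl 0<i = ≤-<-trans (entry≤h 0<i (level<p (next-level lvl))) (begin-strict
    h          <⟨ m<n+m h 1≤h ⟩
    h + h      ≡⟨ cong (_∸ 1) p≡1+2h ⟨
    p ∸ 1      ∎)
    where open ≤-Reasoning
  entry<ceiling (suc k) {i} lvl 0<i = ≤-<-trans (entry≤h 0<i (level<p (next-level lvl))) (begin-strict
    h                                ≤⟨ h≤drop (s≤s z≤n) 2+i<p ⟩
    drop (suc i)                     <⟨ m<m+n (drop (suc i)) (1≤entry (s≤s z≤n) 2+i<p) ⟩
    exit (suc i)                     ∎)
    where
    open ≤-Reasoning
    2+i<p : suc (suc i) < p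
    2+i<p = level<p (next-level {suc i} (next-level {i} lvl))

  switch-level : ∀ k {i} → i + suc k ≡ p ∸ 1 → 0 < i → ∀ {s} → steps i s ≡ exit i →
                 steps (suc i) s ≡ entry i × steps (suc i) s < ceiling (suc i) k
  switch-level k {i} lvl 0<i {s} a≡exit =
    b≡entry , subst (_< ceiling _ k) (sym b≡entry) (entry<ceiling k lvl 0<i)
    where
    b≡entry : steps (suc i) s ≡ entry i
    b≡entry = exit⇒steps≡entry 0<i (level<p (next-level lvl)) s a≡exit

  walkFrom-weaken : ∀ {i i' s} ls → i ≤ i' → WalkFrom i' s ls → WalkFrom i s ls
  walkFrom-weaken []       _    _                = tt
  walkFrom-weaken (l ∷ ls) i≤i' (i'≤l , walk) = ≤-trans i≤i' i'≤l , walk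

  module OneEdge {k i} (lvl : i + k ≡ p ∸ 1) (0<i : 0 < i) {s n} (a+1+n≡c : steps i s + suc n ≡ ceiling i k) where

    1+a<p : suc (steps i s) < p
    1+a<p = ≤-<-trans (subst (suc (steps i s) ≤_) (trans (sym (+-suc _ n)) a+1+n≡c) (s≤s (m≤m+n _ n)))
                      (ceiling<p k lvl 0<i)

    a′≡1+a : steps i ((s + i) % p) ≡ suc (steps i s)
    a′≡1+a = steps-edge 0<i (level<p lvl) s 1+a<p

    a′+n≡c : steps i ((s + i) % p) + n ≡ ceiling i k
    a′+n≡c = trans (cong (_+ n) a′≡1+a) (trans (sym (+-suc _ n)) a+1+n≡c)

  greedy-walk : ∀ k {i} → i + k ≡ p ∸ 1 → 0 < i → ∀ s n → steps i s + n ≡ ceiling i k →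
                WalkFrom i s (greedy i k s n) × length (greedy i k s n) + steps i s ≡ potential i k
  greedy-walk k {i} lvl 0<i s (suc n) a+1+n≡c =
    (≤-refl , <⇒≤pred (level<p lvl) , steps<⇒target≢0 0<i (level<p lvl) s 1+a<p , proj₁ rest) , (begin
      suc (length (greedy i k s′ n)) + steps i s  ≡⟨ +-suc _ (steps i s) ⟨
      length (greedy i k s′ n) + suc (steps i s)  ≡⟨ cong (length (greedy i k s′ n) +_) a′≡1+a ⟨
      length (greedy i k s′ n) + steps i s′       ≡⟨ proj₂ rest ⟩
      potential i k                               ∎)
    where
    open ≡-Reasoning
    open OneEdge lvl 0<i a+1+n≡c
    s′ : ℕ
    s′ = (s + i) % p
    rest : WalkFrom i s′ (greedy i k s′ n) × length (greedy i k s′ n) + steps i s′ ≡ potential i k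
    rest = greedy-walk k lvl 0<i s′ n a′+n≡c
  greedy-walk zero    lvl 0<i s zero a+0≡c = tt , trans (sym (+-identityʳ _)) a+0≡c
  greedy-walk (suc k) {i} lvl 0<i s zero a+0≡c with switch-level k lvl 0<i (trans (sym (+-identityʳ _)) a+0≡c)
  ... | b≡entry , b<c′ = walkFrom-weaken (greedy (suc i) k s n′) (n≤1+n i) (proj₁ rest) , (begin
      L + steps i s                       ≡⟨ cong (L +_) (trans (sym (+-identityʳ _)) a+0≡c) ⟩
      L + (drop i + entry i)              ≡⟨ x∙yz≈y∙xz L (drop i) (entry i) ⟩
      drop i + (L + entry i)              ≡⟨ cong (λ b → drop i + (L + b)) b≡entry ⟨
      drop i + (L + steps (suc i) s)      ≡⟨ cong (drop i +_) (proj₂ rest) ⟩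
      drop i + potential (suc i) k        ∎)
    where
    open ≡-Reasoning
    n′ L : ℕ
    n′ = ceiling (suc i) k ∸ steps (suc i) s
    L  = length (greedy (suc i) k s n′)
    rest : WalkFrom (suc i) s (greedy (suc i) k s n′) × L + steps (suc i) s ≡ potential (suc i) k
    rest = greedy-walk k (next-level lvl) (s≤s z≤n) s n′ (m+[n∸m]≡n (<⇒≤ b<c′))

  tight-walk-is-greedy : ∀ k {i} → i + k ≡ p ∸ 1 → 0 < i → ∀ {s} ls → WalkFrom i s ls →
                         length ls + steps i s ≡ potential i k →
                         ∃[ n ] steps i s + n ≡ ceiling i k × ls ≡ greedy i k s n
  tight-walk-is-greedy zero    lvl 0<i [] _ a≡c = 0 , trans (+-identityʳ _) a≡c , refl
  tight-walk-is-greedy (suc k) {i} lvl 0<i {s} [] _ a≡potential =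
    ⊥-elim (<⇒≱ (steps<p 0<i (level<p lvl) s) (begin
      p                              ≡⟨ suc-pred p ⟨
      1 + (p ∸ 1)                    ≤⟨ +-mono-≤ (1≤drop 0<i (level<p (next-level lvl)))
                                                   (p∸1≤potential (suc i) k) ⟩
      drop i + potential (suc i) k   ≡⟨ a≡potential ⟨
      steps i s                      ∎))
    where open ≤-Reasoning
  tight-walk-is-greedy k {i} lvl 0<i {s} (l ∷ ls) (i≤l , l≤p∸1 , t≢0 , walk) tight
    with m≤n⇒m<n∨m≡n i≤l
  ... | inj₂ refl =
    let n , a′+n≡c , ls≡greedy = tight-walk-is-greedy k lvl 0<i ls walk
                                   (trans (cong (length ls +_) a′≡1+a) (trans (+-suc _ _) tight))
    in  suc n , trans (+-suc _ n) (trans (cong (_+ n) (sym a′≡1+a)) a′+n≡c) , cong (i ∷_) ls≡greedy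
    where
    a′≡1+a : steps i ((s + i) % p) ≡ suc (steps i s)
    a′≡1+a = steps-edge-to-nonzero 0<i (level<p lvl) s t≢0
  tight-walk-is-greedy zero lvl 0<i (l ∷ ls) (i≤l , l≤p∸1 , t≢0 , walk) tight | inj₁ i<l =
    ⊥-elim (no-label-above lvl i<l l≤p∸1)
  tight-walk-is-greedy (suc k) {i} lvl 0<i {s} (l ∷ ls) (i≤l , l≤p∸1 , t≢0 , walk) tight | inj₁ i<l =
    let n′ , b+n′≡c′ , ls≡greedy = tight-walk-is-greedy k (next-level lvl) (s≤s z≤n) (l ∷ ls) walk′
                                     (proj₁ tight-split)
        n′≡c′∸b = trans (sym (m+n∸m≡n (steps (suc i) s) n′)) (cong (_∸ steps (suc i) s) b+n′≡c′)
    in  0 , trans (+-identityʳ _) a≡exit , trans ls≡greedy (cong (greedy (suc i) k s) n′≡c′∸b)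
    where
    1+i<p : suc i < p
    1+i<p = level<p (next-level lvl)
    walk′ : WalkFrom (suc i) s (l ∷ ls)
    walk′ = i<l , l≤p∸1 , t≢0 , walk
    tight-split : length (l ∷ ls) + steps (suc i) s ≡ potential (suc i) k × steps i s ≡ drop i + steps (suc i) s
    tight-split = sum-bounds-tight (walk-length+steps≤potential k (next-level lvl) (s≤s z≤n) (l ∷ ls) walk′)
                                   (steps≤drop+steps 0<i 1+i<p s) tight
    a≡exit : steps i s ≡ exit i
    a≡exit = steps≡drop+steps⇒exit 0<i 1+i<p s (proj₂ tight-split)

  TouchesTop : ℕ → Edge → Set
  TouchesTop j e = Edge.lbl e ≡ j × (Edge.src e ≡ p ∸ 1 ⊎ Edge.tgt e ≡ p ∸ 1)

  greedy-touches-top-with-own-label :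
    ∀ k {i} → i + k ≡ p ∸ 1 → 0 < i → ∀ s n → s < p → 1 ≤ n → steps i s + n ≡ ceiling i k →
    steps i s ≤ steps i (p ∸ 1) → Any (TouchesTop i) (edgesFrom p s (greedy i k s n))
  greedy-touches-top-with-own-label k {i} lvl 0<i s (suc n) s<p _ a+1+n≡c a≤x
    with steps i s ≟ steps i (p ∸ 1)
  ... | yes a≡x = here (refl , inj₁ (steps-injective 0<i (level<p lvl) s<p p∸1<p a≡x))
  greedy-touches-top-with-own-label k {i} lvl 0<i s (suc zero) s<p _ a+1≡c a≤x | no a≢x =
    here (refl , inj₂ (steps-injective 0<i (level<p lvl) (m%n<n (s + i) p) p∸1<p (trans a′≡1+a (sym x≡1+a))))
    where
    open OneEdge lvl 0<i a+1≡c
    x≡1+a : steps i (p ∸ 1) ≡ suc (steps i s)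
    x≡1+a = ≤-antisym (subst (steps i (p ∸ 1) ≤_) (trans (sym a+1≡c) (+-comm _ 1))
                             (steps[p∸1]≤ceiling k lvl 0<i))
                      (≤∧≢⇒< a≤x a≢x)
  greedy-touches-top-with-own-label k {i} lvl 0<i s (suc (suc n)) s<p _ a+2+n≡c a≤x | no a≢x =
    there (greedy-touches-top-with-own-label k lvl 0<i _ (suc n) (m%n<n (s + i) p) (s≤s z≤n) a′+n≡c
             (subst (_≤ steps i (p ∸ 1)) (sym a′≡1+a) (≤∧≢⇒< a≤x a≢x)))
    where open OneEdge lvl 0<i a+2+n≡c

  greedy-touches-top-with-later-labels :
    ∀ k {i} → i + k ≡ p ∸ 1 → 0 < i → ∀ s n → s < p → steps i s + n ≡ ceiling i k →
    ∀ {j} → i < j → j ≤ i + k → Any (TouchesTop j) (edgesFrom p s (greedy i k s n))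
  greedy-touches-top-with-later-labels k lvl 0<i s (suc n) s<p a+1+n≡c i<j j≤i+k =
    there (greedy-touches-top-with-later-labels k lvl 0<i _ n (m%n<n _ p) a′+n≡c i<j j≤i+k)
    where open OneEdge lvl 0<i a+1+n≡c
  greedy-touches-top-with-later-labels zero {i} lvl 0<i s zero s<p a≡c i<j j≤i+0 =
    ⊥-elim (<⇒≱ i<j (subst (_ ≤_) (+-identityʳ i) j≤i+0))
  greedy-touches-top-with-later-labels (suc k) {i} lvl 0<i s zero s<p a+0≡c {j} i<j j≤i+1+k
    with switch-level k lvl 0<i (trans (sym (+-identityʳ _)) a+0≡c) | m≤n⇒m<n∨m≡n i<j
  ... | b≡entry , b<c′ | inj₂ refl =
    greedy-touches-top-with-own-label k (next-level lvl) (s≤s z≤n) s _ s<p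
      (m<n⇒0<n∸m b<c′) (m+[n∸m]≡n (<⇒≤ b<c′))
      (subst (_≤ steps (suc i) (p ∸ 1)) (sym b≡entry) (entry≤steps[p∸1] 0<i (level<p (next-level lvl))))
  ... | _ , b<c′ | inj₁ 1+i<j =
    greedy-touches-top-with-later-labels k (next-level lvl) (s≤s z≤n) s _ s<p (m+[n∸m]≡n (<⇒≤ b<c′)) 1+i<j
      (subst (j ≤_) (+-suc i k) j≤i+1+k)

  1≤ceiling : ∀ k {i} → i + k ≡ p ∸ 1 → 0 < i → 1 ≤ ceiling i k
  1≤ceiling zero    lvl 0<i = n≢0⇒n>0 p∸1≢0
  1≤ceiling (suc k) lvl 0<i = ≤-trans (1≤drop 0<i (level<p (next-level lvl))) (m≤m+n _ _)

  k₀ : ℕ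
  k₀ = h + h ∸ 1

  level-1 : 1 + k₀ ≡ p ∸ 1
  level-1 = trans (m+[n∸m]≡n (≤-trans 1≤h (m≤m+n h h))) (cong (_∸ 1) (sym p≡1+2h))

  longest : List ℕ
  longest = greedy 1 k₀ 0 (ceiling 1 k₀)

  steps[1,0]≡0 : steps 1 0 ≡ 0
  steps[1,0]≡0 = steps-0 (s≤s z≤n) (level<p level-1)

  +steps[1,0] : ∀ n → n + steps 1 0 ≡ n
  +steps[1,0] n = trans (cong (n +_) steps[1,0]≡0) (+-identityʳ n)

  longest-greedy : WalkFrom 1 0 longest × length longest + steps 1 0 ≡ potential 1 k₀
  longest-greedy = greedy-walk k₀ level-1 (s≤s z≤n) 0 (ceiling 1 k₀) (cong (_+ ceiling 1 k₀) steps[1,0]≡0)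

  longest-uniqueMaximal : UniqueMaximal (IsWalk p) longest
  longest-uniqueMaximal = walkFrom⇒isWalk longest (proj₁ longest-greedy) , maximal , unique
    where
    length-longest : length longest ≡ potential 1 k₀
    length-longest = trans (sym (+steps[1,0] _)) (proj₂ longest-greedy)
    maximal : ∀ w → IsWalk p w → length w ≤ length longest
    maximal w walk = subst₂ _≤_ (+steps[1,0] (length w)) (sym length-longest)
                       (walk-length+steps≤potential k₀ level-1 (s≤s z≤n) w (isWalk⇒walkFrom w walk))
    unique : ∀ w → IsWalk p w → length w ≡ length longest → w ≡ longest
    unique w walk |w|≡|longest| =
      let n , 0+n≡c , w≡greedy = tight-walk-is-greedy k₀ level-1 (s≤s z≤n) w (isWalk⇒walkFrom w walk)
                                   (trans (+steps[1,0] (length w)) (trans |w|≡|longest| length-longest))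
      in  trans w≡greedy (cong (greedy 1 k₀ 0) (trans (sym (cong (_+ n) steps[1,0]≡0)) 0+n≡c))

  longest-recurrent : Recurrent p longest
  longest-recurrent j 1≤j j≤p∸1 with m≤n⇒m<n∨m≡n 1≤j
  ... | inj₂ refl = greedy-touches-top-with-own-label k₀ level-1 (s≤s z≤n) 0 _ 0<p
                      (1≤ceiling k₀ level-1 (s≤s z≤n))
                      (cong (_+ ceiling 1 k₀) steps[1,0]≡0) (subst (_≤ steps 1 (p ∸ 1)) (sym steps[1,0]≡0) z≤n)
  ... | inj₁ 1<j  = greedy-touches-top-with-later-labels k₀ level-1 (s≤s z≤n) 0 _ 0<p
                      (cong (_+ ceiling 1 k₀) steps[1,0]≡0) 1<j (subst (j ≤_) (sym level-1) j≤p∸1)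

uniqueMaximal-∩ : ∀ {P Q : List ℕ → Set} {w} → UniqueMaximal P w → Q w → UniqueMaximal (λ v → P v × Q v) w
uniqueMaximal-∩ (Pw , maximal , unique) Qw = (Pw , Qw) , (λ v → maximal v ∘ proj₁) , (λ v → unique v ∘ proj₁)

odd-prime-half : ∀ {p} → Prime p → p ≢ 2 → ∃[ h ] p ≡ suc (h + h) × 1 ≤ h
odd-prime-half {p} p-prime p≢2 with p % 2 in p%2≡r | m%n<n p 2
... | 0 | _ =
  ⊥-elim ([ (λ ()) , (λ 2≡p → p≢2 (sym 2≡p)) ]′ (prime⇒irreducible p-prime (m%n≡0⇒n∣m p 2 p%2≡r)))
  where instance _ = prime⇒nonZero p-prime
... | 1 | _ = h , p≡1+2h , n≢0⇒n>0 h≢0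
  where
  instance _ = prime⇒nonZero p-prime
  h : ℕ
  h = p / 2
  p≡1+2h : p ≡ suc (h + h)
  p≡1+2h = trans (m≡m%n+[m/n]*n p 2) (cong₂ _+_ p%2≡r (trans (*-comm h 2) (cong (h +_) (+-identityʳ h))))
  h≢0 : h ≢ 0
  h≢0 h≡0 = <⇒≢ (nonTrivial⇒n>1 p) (sym (trans p≡1+2h (cong (λ x → suc (x + x)) h≡0)))
    where instance _ = prime⇒nonTrivial p-prime
... | suc (suc _) | s≤s (s≤s ())

theorem4p6 : (p : ℕ) → .{{_ : NonZero p}} → Prime p → p ≢ 2 →
    Σ (List ℕ) λ w →
      UniqueMaximal (IsWalk p) w ×
      UniqueMaximal (λ v → IsWalk p v × Recurrent p v) w
theorem4p6 p p-prime p≢2 =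
  let h , p≡1+2h , 1≤h = odd-prime-half p-prime p≢2
      open OddPrime p p-prime h p≡1+2h 1≤h
  in  longest , longest-uniqueMaximal , uniqueMaximal-∩ longest-uniqueMaximal longest-recurrent
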